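{- Let $k\ge 2$ and $i\in\{1,\dots,k-1\}$. If $\binom{k}{i}$ and $\binom{k-1}{i}$ are odd and $k$ is even, then $$S=\sum_{\substack{\ell=0\\ \ell\ \text{even}}}^{k-i-2}\binom{k-i}{\ell}\binom{i-2}{k-i-\ell-2}^2$$ is odd.
   Context: Binomial coefficients are defined for integer $a$ and $b$ by $\binom{a}{b}=a(a-1)\cdots(a-b+1)/b!$ if $b\ge 0$ and $\binom{a}{b}=0$ if $b<0$. -}

module Defs where

open import Data.Nat using (ℕ; zero; suc; _+_; _∸_)
open import Data.Nat.Combinatorics using (_C_)
open import Data.Integer using (ℤ; +_; -[1+_]; -_)
import Data.Integer
open import Data.List using (List; []; _∷_; upTo; filter; map; sum)

-- Generalized binomial coefficient  binom(a, b)  for integer a and natural b,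
-- binom(a,b) = a(a-1)...(a-b+1)/b!.
-- For a ≥ 0 this is the usual  a C b ; for a = -(m+1) it equals
-- (-1)^b * binom(m+b, b).
signPow : ℕ → ℤ → ℤ
signPow zero    x = x
signPow (suc b) x = - signPow b x

binomℤ : ℤ → ℕ → ℤ
binomℤ (+ n)      b = + (n C b)
binomℤ -[1+ m ]   b = signPow b (+ ((m + b) C b))

sumℤ : List ℤ → ℤ
sumℤ []       = + 0
sumℤ (x ∷ xs) = x Data.Integer.+ sumℤ xs

-- Modulo 2 the squares in S can be dropped and, since k − i is even, so can the condition that ℓ be
-- even: C(k − i, ℓ) is even for odd ℓ. What is left is the Vandermonde convolution
-- Σ_ℓ C(k − i, ℓ) C(i − 2, k − i − 2 − ℓ) = C(k − 2, k − i − 2) = C(k − 2, i), and by Pascal's rule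
-- C(k − 1, i) = C(k − 2, i − 1) + C(k − 2, i), where C(k − 2, i − 1) is again even-over-odd.
module Submission where

open import Defs
open import Data.Nat using (ℕ; _≤_; _∸_; _+_)
open import Data.Nat.Combinatorics using (_C_)
open import Data.Nat.Divisibility using (_∣_)
open import Data.Nat.Divisibility using (_∣?_)
open import Relation.Nullary.Decidable using (¬?)
open import Data.Integer using (ℤ; +_; _-_; _*_)
open import Data.Integer.Divisibility using () renaming (_∣_ to _∣ℤ_)
open import Data.List using (upTo; filter; map)
open import Relation.Nullary using (¬_)

open import Data.Nat as ℕ using (zero; suc; s≤s; z≤n; parity; >-nonZero)
open import Data.Nat.Properties
  using (+-identityʳ; *-distribʳ-+; +-comm; +-suc; m≤m+n; m+n∸m≡n; m+[n∸m]≡n;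
         ∸-+-assoc; <⇒≤; ≤-trans; m<n⇒0<n∸m; m≤pred[n]⇒suc[m]≤n; +-commutativeSemigroup)
open import Data.Nat.Combinatorics using (nCk+nC[k+1]≡[n+1]C[k+1]; nCk≡nC[n∸k]; nC1≡n)
open import Data.Nat.Divisibility using (divides)
open import Data.Nat.ListAction using (sum)
open import Data.Parity using (0ℙ; 1ℙ) renaming (_+_ to _+ℙ_; _*_ to _*ℙ_)
import Data.Parity.Properties as ℙ
open import Data.Integer using () renaming (_+_ to _+ℤ_)
open import Data.Integer.Properties using (pos-*; pos-+)
open import Data.List using ([]; _∷_; applyUpTo)
open import Data.List.Properties using (map-cong; map-∘; map-upTo)
open import Relation.Nullary using (yes; no; contradiction)
open import Relation.Unary using (Decidable)
open import Relation.Binary.PropositionalEquality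
open import Function using (_∘_)
open import Algebra.Properties.CommutativeSemigroup +-commutativeSemigroup using (interchange; x∙yz≈y∙xz)

2∣⇒parity≡0ℙ : ∀ {n} → 2 ∣ n → parity n ≡ 0ℙ
2∣⇒parity≡0ℙ (divides q refl) = trans (ℙ.*-homo-* q 2) (ℙ.*-zeroʳ (parity q))

parity≡0ℙ⇒2∣ : ∀ n → parity n ≡ 0ℙ → 2 ∣ n
parity≡0ℙ⇒2∣ zero          _ = divides 0 refl
parity≡0ℙ⇒2∣ (suc (suc n)) p with parity≡0ℙ⇒2∣ n p
... | divides q n≡q*2 = divides (suc q) (cong (λ m → suc (suc m)) n≡q*2)

¬2∣⇒parity≡1ℙ : ∀ {n} → ¬ 2 ∣ n → parity n ≡ 1ℙ
¬2∣⇒parity≡1ℙ {n} ¬2∣n with parity n in eq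
... | 0ℙ = contradiction (parity≡0ℙ⇒2∣ n eq) ¬2∣n
... | 1ℙ = refl

parity[1+n]≡1ℙ : ∀ {n} → parity n ≡ 0ℙ → parity (suc n) ≡ 1ℙ
parity[1+n]≡1ℙ {n} n-even = trans (ℙ.+-homo-+ 1 n) (cong (1ℙ +ℙ_) n-even)

1≤n∧parity≡0ℙ⇒2≤n : ∀ {n} → 1 ≤ n → parity n ≡ 0ℙ → 2 ≤ n
1≤n∧parity≡0ℙ⇒2≤n {suc (suc n)} _ _ = s≤s (s≤s z≤n)
1≤n∧parity≡0ℙ⇒2≤n {suc zero}    _ ()

C-sym : ∀ {a b c} → a + b ≡ c → c C a ≡ c C b
C-sym {a} {b} refl = trans (nCk≡nC[n∸k] (m≤m+n a b)) (cong ((a + b) C_) (m+n∸m≡n a b))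

parity-pascal² : ∀ n k → parity (suc (suc n) C suc (suc k)) ≡ parity (n C k) +ℙ parity (n C suc (suc k))
parity-pascal² n k = begin
  parity (suc (suc n) C suc (suc k))
    ≡⟨ cong parity (sym (nCk+nC[k+1]≡[n+1]C[k+1] (suc n) (suc k))) ⟩
  parity (suc n C suc k + suc n C suc (suc k))
    ≡⟨ cong parity (sym (cong₂ _+_ (nCk+nC[k+1]≡[n+1]C[k+1] n k) (nCk+nC[k+1]≡[n+1]C[k+1] n (suc k)))) ⟩
  parity ((a + b) + (b + c))
    ≡⟨ trans (ℙ.+-homo-+ (a + b) (b + c)) (cong₂ _+ℙ_ (ℙ.+-homo-+ a b) (ℙ.+-homo-+ b c)) ⟩
  (pa +ℙ pb) +ℙ (pb +ℙ pc)
    ≡⟨ ℙ.+-assoc pa pb (pb +ℙ pc) ⟩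
  pa +ℙ (pb +ℙ (pb +ℙ pc))
    ≡⟨ cong (pa +ℙ_) (trans (sym (ℙ.+-assoc pb pb pc)) (cong (_+ℙ pc) (ℙ.p+p≡0ℙ pb))) ⟩
  pa +ℙ pc ∎
  where
  open ≡-Reasoning
  a = n C k
  b = n C suc k
  c = n C suc (suc k)
  pa = parity a
  pb = parity b
  pc = parity c

parity[nCk]≡0ℙ : ∀ n k → parity n ≡ 0ℙ → parity k ≡ 1ℙ → parity (n C k) ≡ 0ℙ
parity[nCk]≡0ℙ zero          (suc k)       _      _     = refl
parity[nCk]≡0ℙ (suc (suc n)) 1             n-even _     = trans (cong parity (nC1≡n (suc (suc n)))) n-even
parity[nCk]≡0ℙ (suc (suc n)) (suc (suc k)) n-even k-odd = begin
  parity (suc (suc n) C suc (suc k))         ≡⟨ parity-pascal² n k ⟩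
  parity (n C k) +ℙ parity (n C suc (suc k)) ≡⟨ cong₂ _+ℙ_ (parity[nCk]≡0ℙ n k n-even k-odd)
                                                          (parity[nCk]≡0ℙ n (suc (suc k)) n-even k-odd) ⟩
  0ℙ                                         ∎
  where open ≡-Reasoning
parity[nCk]≡0ℙ zero          zero          _      ()
parity[nCk]≡0ℙ 1             _             ()     _
parity[nCk]≡0ℙ (suc (suc n)) zero          _      ()

parity[nCk]≡1ℙ⇒parity[k]≡0ℙ : ∀ n k → parity n ≡ 0ℙ → parity (n C k) ≡ 1ℙ → parity k ≡ 0ℙ
parity[nCk]≡1ℙ⇒parity[k]≡0ℙ n k n-even nCk-odd with parity k in eq
... | 0ℙ = refl
... | 1ℙ = contradiction (trans (sym nCk-odd) (parity[nCk]≡0ℙ n k n-even eq)) λ ()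

parity-pascal-odd : ∀ n k → parity n ≡ 0ℙ → parity k ≡ 1ℙ → parity (suc n C suc k) ≡ parity (n C suc k)
parity-pascal-odd n k n-even k-odd = begin
  parity (suc n C suc k)               ≡⟨ cong parity (sym (nCk+nC[k+1]≡[n+1]C[k+1] n k)) ⟩
  parity (n C k + n C suc k)           ≡⟨ ℙ.+-homo-+ (n C k) (n C suc k) ⟩
  parity (n C k) +ℙ parity (n C suc k) ≡⟨ cong (_+ℙ parity (n C suc k)) (parity[nCk]≡0ℙ n k n-even k-odd) ⟩
  parity (n C suc k)                   ∎
  where open ≡-Reasoning

sum-applyUpTo-cong : ∀ {f g : ℕ → ℕ} n → (∀ j → f j ≡ g j) → sum (applyUpTo f n) ≡ sum (applyUpTo g n)
sum-applyUpTo-cong zero    f≗g = refl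
sum-applyUpTo-cong (suc n) f≗g = cong₂ _+_ (f≗g 0) (sum-applyUpTo-cong n (λ j → f≗g (suc j)))

sum-applyUpTo-+ : ∀ (f g : ℕ → ℕ) n →
  sum (applyUpTo (λ j → f j + g j) n) ≡ sum (applyUpTo f n) + sum (applyUpTo g n)
sum-applyUpTo-+ f g zero    = refl
sum-applyUpTo-+ f g (suc n) = trans (cong (_+_ (f 0 + g 0)) (sum-applyUpTo-+ (λ j → f (suc j)) (λ j → g (suc j)) n))
                                   (interchange (f 0) (g 0) _ _)

sum-applyUpTo-0 : ∀ n → sum (applyUpTo (λ _ → 0) n) ≡ 0
sum-applyUpTo-0 zero    = refl
sum-applyUpTo-0 (suc n) = sum-applyUpTo-0 n

vandermonde : ∀ m n r → sum (applyUpTo (λ ℓ → (m C ℓ) ℕ.* (n C (r ∸ ℓ))) (suc r)) ≡ (m + n) C r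
vandermonde zero    n r       = trans (cong₂ _+_ (+-identityʳ (n C r)) (sum-applyUpTo-0 r)) (+-identityʳ (n C r))
vandermonde (suc m) n zero    = refl
vandermonde (suc m) n (suc r) = begin
  1 ℕ.* (n C suc r) + sum (applyUpTo (λ j → (suc m C suc j) ℕ.* (n C (r ∸ j))) (suc r))
    ≡⟨ cong (_+_ (1 ℕ.* (n C suc r))) (trans (sum-applyUpTo-cong (suc r) pascal) (sum-applyUpTo-+ f g (suc r))) ⟩
  1 ℕ.* (n C suc r) + (sum (applyUpTo f (suc r)) + sum (applyUpTo g (suc r)))
    ≡⟨ x∙yz≈y∙xz (1 ℕ.* (n C suc r)) (sum (applyUpTo f (suc r))) (sum (applyUpTo g (suc r))) ⟩
  sum (applyUpTo f (suc r)) + (1 ℕ.* (n C suc r) + sum (applyUpTo g (suc r)))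
    ≡⟨ cong₂ _+_ (vandermonde m n r) (vandermonde m n (suc r)) ⟩
  (m + n) C r + (m + n) C suc r
    ≡⟨ nCk+nC[k+1]≡[n+1]C[k+1] (m + n) r ⟩
  suc (m + n) C suc r ∎
  where
  open ≡-Reasoning
  f g : ℕ → ℕ
  f j = (m C j) ℕ.* (n C (r ∸ j))
  g j = (m C suc j) ℕ.* (n C (r ∸ j))
  pascal : ∀ j → (suc m C suc j) ℕ.* (n C (r ∸ j)) ≡ f j + g j
  pascal j = trans (cong (ℕ._* (n C (r ∸ j))) (sym (nCk+nC[k+1]≡[n+1]C[k+1] m j)))
                   (*-distribʳ-+ (n C (r ∸ j)) (m C j) (m C suc j))

parity-sum-cong : ∀ {A : Set} {f g : A → ℕ} xs → (∀ x → parity (f x) ≡ parity (g x)) →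
  parity (sum (map f xs)) ≡ parity (sum (map g xs))
parity-sum-cong                 []       _  = refl
parity-sum-cong {f = f} {g = g} (x ∷ xs) eq = begin
  parity (f x + sum (map f xs))              ≡⟨ ℙ.+-homo-+ (f x) _ ⟩
  parity (f x) +ℙ parity (sum (map f xs))    ≡⟨ cong₂ _+ℙ_ (eq x) (parity-sum-cong xs eq) ⟩
  parity (g x) +ℙ parity (sum (map g xs))    ≡⟨ ℙ.+-homo-+ (g x) _ ⟨
  parity (g x + sum (map g xs))              ∎
  where open ≡-Reasoning

parity-sum-filter : ∀ {A : Set} {P : A → Set} (P? : Decidable P) {f : A → ℕ} xs →
  (∀ x → ¬ P x → parity (f x) ≡ 0ℙ) → parity (sum (map f (filter P? xs))) ≡ parity (sum (map f xs))
parity-sum-filter P?         []       _    = refl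
parity-sum-filter P? {f = f} (x ∷ xs) even with P? x
... | yes _  = trans (ℙ.+-homo-+ (f x) _)
                 (trans (cong (parity (f x) +ℙ_) (parity-sum-filter P? xs even)) (sym (ℙ.+-homo-+ (f x) _)))
... | no ¬Px = trans (parity-sum-filter P? xs even)
                 (trans (sym (cong (_+ℙ _) (even x ¬Px))) (sym (ℙ.+-homo-+ (f x) _)))

sumℤ-map-pos : ∀ ns → sumℤ (map +_ ns) ≡ + sum ns
sumℤ-map-pos []       = refl
sumℤ-map-pos (n ∷ ns) = trans (cong ((+ n) +ℤ_) (sumℤ-map-pos ns)) (sym (pos-+ n (sum ns)))

-- S m a is the sum S of the statement with m = k − i and a = i − 2.
S : ℕ → ℤ → ℤ
S m a = sumℤ (map (λ ℓ → + (m C ℓ) * (binomℤ a (m ∸ ℓ ∸ 2) * binomℤ a (m ∸ ℓ ∸ 2)))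
                  (filter (2 ∣?_) (upTo (m ∸ 1))))

Sℕ-summand : ℕ → ℕ → ℕ → ℕ
Sℕ-summand m n ℓ = (m C ℓ) ℕ.* ((n C (m ∸ ℓ ∸ 2)) ℕ.* (n C (m ∸ ℓ ∸ 2)))

Sℕ : ℕ → ℕ → ℕ
Sℕ m n = sum (map (Sℕ-summand m n) (filter (2 ∣?_) (upTo (m ∸ 1))))

S-pos : ∀ m n → S m (+ n) ≡ + Sℕ m n
S-pos m n = begin
  S m (+ n)                              ≡⟨ cong sumℤ (map-cong summand-pos xs) ⟩
  sumℤ (map (+_ ∘ Sℕ-summand m n) xs)    ≡⟨ cong sumℤ (map-∘ xs) ⟩
  sumℤ (map +_ (map (Sℕ-summand m n) xs)) ≡⟨ sumℤ-map-pos (map (Sℕ-summand m n) xs) ⟩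
  + Sℕ m n                               ∎
  where
  open ≡-Reasoning
  xs = filter (2 ∣?_) (upTo (m ∸ 1))
  summand-pos : ∀ ℓ → + (m C ℓ) * (+ (n C (m ∸ ℓ ∸ 2)) * + (n C (m ∸ ℓ ∸ 2))) ≡ + Sℕ-summand m n ℓ
  summand-pos ℓ = sym (trans (pos-* (m C ℓ) _) (cong (+ (m C ℓ) *_) (pos-* (n C (m ∸ ℓ ∸ 2)) _)))

parity-Sℕ : ∀ r n → parity r ≡ 0ℙ → parity (Sℕ (2 + r) n) ≡ parity ((2 + r + n) C r)
parity-Sℕ r n r-even = begin
  parity (Sℕ m n)                        ≡⟨ parity-sum-filter (2 ∣?_) {term} (upTo (suc r)) odd-terms-even ⟩
  parity (sum (map term (upTo (suc r))))  ≡⟨ parity-sum-cong {f = term} {g = conv} (upTo (suc r)) drop-square ⟩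
  parity (sum (map conv (upTo (suc r))))  ≡⟨ cong (parity ∘ sum) (map-upTo conv (suc r)) ⟩
  parity (sum (applyUpTo conv (suc r)))   ≡⟨ cong parity (vandermonde m n r) ⟩
  parity ((m + n) C r)                    ∎
  where
  open ≡-Reasoning
  m = 2 + r
  term conv : ℕ → ℕ
  term = Sℕ-summand m n
  conv ℓ = (m C ℓ) ℕ.* (n C (r ∸ ℓ))
  odd-terms-even : ∀ ℓ → ¬ 2 ∣ ℓ → parity (term ℓ) ≡ 0ℙ
  odd-terms-even ℓ ¬2∣ℓ = trans (ℙ.*-homo-* (m C ℓ) square)
                                (cong (_*ℙ parity square) (parity[nCk]≡0ℙ m ℓ r-even (¬2∣⇒parity≡1ℙ ¬2∣ℓ)))
    where square = (n C (m ∸ ℓ ∸ 2)) ℕ.* (n C (m ∸ ℓ ∸ 2))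
  drop-square : ∀ ℓ → parity (term ℓ) ≡ parity (conv ℓ)
  drop-square ℓ = begin
    parity (term ℓ)                           ≡⟨ cong (λ j → parity ((m C ℓ) ℕ.* ((n C j) ℕ.* (n C j)))) m∸ℓ∸2≡r∸ℓ ⟩
    parity ((m C ℓ) ℕ.* ((n C (r ∸ ℓ)) ℕ.* (n C (r ∸ ℓ))))
      ≡⟨ trans (ℙ.*-homo-* (m C ℓ) _) (cong (parity (m C ℓ) *ℙ_) (ℙ.*-homo-* (n C (r ∸ ℓ)) _)) ⟩
    parity (m C ℓ) *ℙ (parity (n C (r ∸ ℓ)) *ℙ parity (n C (r ∸ ℓ)))
      ≡⟨ cong (parity (m C ℓ) *ℙ_) (ℙ.*-idem (parity (n C (r ∸ ℓ)))) ⟩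
    parity (m C ℓ) *ℙ parity (n C (r ∸ ℓ))    ≡⟨ ℙ.*-homo-* (m C ℓ) (n C (r ∸ ℓ)) ⟨
    parity (conv ℓ)                           ∎
    where
    m∸ℓ∸2≡r∸ℓ : m ∸ ℓ ∸ 2 ≡ r ∸ ℓ
    m∸ℓ∸2≡r∸ℓ = trans (∸-+-assoc m ℓ 2) (cong (m ∸_) (+-comm ℓ 2))

S-odd : ∀ i m → 2 ≤ i → 2 ≤ m → parity i ≡ 0ℙ → parity m ≡ 0ℙ →
        parity ((i + m ∸ 1) C i) ≡ 1ℙ → ¬ (+ 2 ∣ℤ S m (+ i - + 2))
S-odd (suc (suc n)) (suc (suc r)) (s≤s (s≤s z≤n)) (s≤s (s≤s z≤n)) n-even r-even row-odd 2∣S =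
  -- 2∣S is accepted as evidence about S (2 + r) (+ n) because + (2 + n) - + 2 computes to + n.
  ℙ.p≢p⁻¹ 0ℙ (begin
    0ℙ                                   ≡⟨ 2∣⇒parity≡0ℙ (subst (+ 2 ∣ℤ_) (S-pos (2 + r) n) 2∣S) ⟨
    parity (Sℕ (2 + r) n)                ≡⟨ parity-Sℕ r n r-even ⟩
    parity ((2 + r + n) C r)             ≡⟨ cong parity (C-sym {r} {2 + n} (trans (+-suc r (suc n)) (cong suc (+-suc r n)))) ⟩
    parity ((2 + r + n) C (2 + n))       ≡⟨ cong (λ K → parity (K C (2 + n))) (+-comm (2 + r) n) ⟩
    parity ((n + (2 + r)) C (2 + n))     ≡⟨ parity-pascal-odd (n + (2 + r)) (suc n) K-even (parity[1+n]≡1ℙ {n} n-even) ⟨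
    parity ((suc n + (2 + r)) C (2 + n)) ≡⟨ row-odd ⟩
    1ℙ                                   ∎)
  where
  open ≡-Reasoning
  K-even : parity (n + (2 + r)) ≡ 0ℙ
  K-even = trans (ℙ.+-homo-+ n (2 + r)) (cong₂ _+ℙ_ n-even r-even)

lemma3p14 : (k i : ℕ) → 2 ≤ k → 1 ≤ i → i ≤ k ∸ 1 →
    ¬ (2 ∣ k C i) → ¬ (2 ∣ (k ∸ 1) C i) → 2 ∣ k →
    ¬ ((+ 2) ∣ℤ sumℤ (map (λ ℓ → (+ ((k ∸ i) C ℓ)) * (binomℤ ((+ i) - (+ 2)) (k ∸ i ∸ ℓ ∸ 2) * binomℤ ((+ i) - (+ 2)) (k ∸ i ∸ ℓ ∸ 2))) (filter (2 ∣?_) (upTo (k ∸ i ∸ 1)))))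
lemma3p14 k i 2≤k 1≤i i≤k∸1 kCi-odd [k∸1]Ci-odd 2∣k =
  S-odd i m (1≤n∧parity≡0ℙ⇒2≤n 1≤i i-even) (1≤n∧parity≡0ℙ⇒2≤n (m<n⇒0<n∸m i<k) m-even)
        i-even m-even row-odd
  where
  m = k ∸ i
  k-even : parity k ≡ 0ℙ
  k-even = 2∣⇒parity≡0ℙ 2∣k
  i<k : i ℕ.< k
  i<k = m≤pred[n]⇒suc[m]≤n {{>-nonZero (≤-trans (s≤s z≤n) 2≤k)}} i≤k∸1
  i+m≡k : i + m ≡ k
  i+m≡k = m+[n∸m]≡n (<⇒≤ i<k)
  i-even : parity i ≡ 0ℙ
  i-even = parity[nCk]≡1ℙ⇒parity[k]≡0ℙ k i k-even (¬2∣⇒parity≡1ℙ kCi-odd)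
  m-even : parity m ≡ 0ℙ
  m-even = trans (cong (_+ℙ parity m) (sym i-even))
                 (trans (sym (ℙ.+-homo-+ i m)) (trans (cong parity i+m≡k) k-even))
  row-odd : parity ((i + m ∸ 1) C i) ≡ 1ℙ
  row-odd = subst (λ K → parity ((K ∸ 1) C i) ≡ 1ℙ) (sym i+m≡k) (¬2∣⇒parity≡1ℙ [k∸1]Ci-odd)
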